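{- Let $O=\{o_1,\ldots,o_r\}$ and $V=\{v_1,\ldots,v_n\}$ be disjoint sets of labeled vertices, and let $T$ be an $O$-rooted labeled $r$-tree on $O\cup V$. For each $i\in[n]$, the father set $F_T^\nu(v_i)$ is the same for all valid rearrangements $\nu$ for $T$.
   Context: An $O$-rooted labeled $r$-tree on $O\cup V$ is a graph $T$ on $O\cup V$ admitting a valid rearrangement. A valid rearrangement is an ordering $\nu=(v_{i_1},\ldots,v_{i_n})$ of $v_1,\ldots,v_n$ such that, for each $j\in[n]$, $v_{i_j}$ is adjacent to exactly $r$ vertices of $\{o_1,\ldots,o_r,v_{i_1},\ldots,v_{i_{j-1}}\}$, and these $r$ vertices are mutually adjacent in $T$. For such $\nu$, the father set is \[F_T^\nu(v_{i_j})=\{v: v\text{ adjacent to }v_{i_j}\text{ in }T\}\cap\{o_1,\ldots,o_r,v_{i_1},\ldots,v_{i_{j-1}}\}.\] -}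

module Defs where

open import Data.Nat using (ℕ; _<ᵇ_)
open import Data.Fin using (Fin; toℕ)
open import Data.Sum using (_⊎_; inj₁; inj₂)
open import Data.Product using (_×_; Σ; ∃; _,_)
open import Data.Bool using (Bool; true; false; T?; _∧_)
open import Data.List using (List; filter; length; allFin; map; _++_)
open import Relation.Binary.PropositionalEquality using (_≡_)
open import Relation.Nullary using (¬_)
open import Relation.Unary using (Pred; Decidable)
open import Function.Bundles using (_↔_; Inverse)
open import Level using (0ℓ)

-- Vertex set O ∪ V with O = {o_1..o_r} (inj₁) and V = {v_1..v_n} (inj₂), disjoint.
Vertex : ℕ → ℕ → Set
Vertex r n = Fin r ⊎ Fin n

allVertices : ∀ r n → List (Vertex r n)
allVertices r n = map inj₁ (allFin r) ++ map inj₂ (allFin n)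

record Graph (r n : ℕ) : Set where
  field
    adj       : Vertex r n → Vertex r n → Bool
    symmetric : ∀ x y → adj x y ≡ adj y x
    irreflex  : ∀ x → adj x x ≡ false
open Graph public

Adjacent : ∀ {r n} → Graph r n → Vertex r n → Vertex r n → Set
Adjacent G x y = adj G x y ≡ true

-- An ordering ν = (v_{i_1},…,v_{i_n}) of v_1..v_n: position j ↦ index i_j, a bijection.
Ordering : ℕ → Set
Ordering n = Fin n ↔ Fin n

open Inverse

Before : ∀ {r n} → Ordering n → Fin n → Vertex r n → Bool
Before ν j (inj₁ _) = true
Before ν j (inj₂ i) = toℕ (from ν i) <ᵇ toℕ j

adjBefore : ∀ {r n} → Graph r n → Ordering n → Fin n → List (Vertex r n)
adjBefore {r} {n} G ν j =
  filter (λ u → T? (adj G (inj₂ (to ν j)) u ∧ Before ν j u))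
         (allVertices r n)

ValidRearrangement : ∀ {r n} → Graph r n → Ordering n → Set
ValidRearrangement {r} {n} G ν =
  ∀ (j : Fin n) →
    length (adjBefore G ν j) ≡ r ×
    (∀ x y → Adjacent G (inj₂ (to ν j)) x → Before ν j x ≡ true →
             Adjacent G (inj₂ (to ν j)) y → Before ν j y ≡ true →
             ¬ (x ≡ y) → Adjacent G x y)

IsRootedRTree : ∀ {r n} → Graph r n → Set
IsRootedRTree {r} {n} G = Σ (Ordering n) (ValidRearrangement G)

FatherSet : ∀ {r n} → Graph r n → Ordering n → Fin n → Vertex r n → Set
FatherSet G ν i u = Adjacent G (inj₂ i) u × Before ν (from ν i) u ≡ true

-- Prove F^ν(x) ⊆ F^ν′(x) for x ∈ V in decreasing order of ν-position; the
-- reverse inclusion is the same statement with ν, ν′ swapped.  If a neighbour y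
-- of x precedes x in ν′ but follows it in ν, then x ∈ F^ν(y) ⊆ F^ν′(y), so x
-- precedes y in ν′: impossible.  Hence F^ν′(x) ⊆ F^ν(x), and as both sets have
-- exactly r elements they coincide.
module Submission where

open import Defs
open import Data.Bool using (Bool; true; T; T?; _∧_)
open import Data.Bool.Properties using (T-≡; T-∧)
open import Data.Empty using (⊥-elim)
open import Data.Fin using (Fin; _<_; _>_)
open import Data.Fin.Induction using (>-wellFounded)
open import Data.Fin.Properties using (<-cmp; <-asym)
open import Data.List using (List; filter; length; allFin; map)
open import Data.List.Membership.Propositional using (_∈_)
open import Data.List.Membership.Propositional.Properties
  using (∈-filter⁺; ∈-filter⁻; ∈-allFin; ∈-map⁺; ∈-++⁺ˡ; ∈-++⁺ʳ)
open import Data.List.Relation.Binary.Pointwise using (Pointwise-≡⇒≡)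
open import Data.List.Relation.Binary.Sublist.Heterogeneous.Properties
  using (toPointwise; ⊆-filter-Sublist)
open import Data.List.Relation.Binary.Sublist.Propositional using (⊆-refl)
open import Data.Nat using (ℕ)
open import Data.Nat.Properties using (<ᵇ⇒<; <⇒<ᵇ)
open import Data.Product using (_×_; _,_; proj₁; proj₂)
import Data.Product as Product
open import Data.Sum using (inj₁; inj₂)
open import Function using (_∘_)
open import Function.Bundles using (Equivalence; Injection; Inverse)
open import Function.Properties.Inverse using (↔⇒↣; ↔-sym)
open import Induction.WellFounded using (module All)
open import Level using (0ℓ)
open import Relation.Binary using (tri<; tri≈; tri>)
open import Relation.Binary.Construct.On using (wellFounded)
open import Relation.Binary.PropositionalEquality using (_≡_; refl; sym; trans; subst)
open import Relation.Nullary using (¬_; contradiction)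
open import Relation.Unary using (Pred; Decidable; _⊆_)

open Inverse

module _ {a p q} {A : Set a} {P : Pred A p} {Q : Pred A q}
         (P? : Decidable P) (Q? : Decidable Q) where

  filter-length-≡⇒⊇ : Q ⊆ P → ∀ {xs} →
                      length (filter Q? xs) ≡ length (filter P? xs) →
                      ∀ {x} → x ∈ xs → P x → Q x
  filter-length-≡⇒⊇ Q⊆P {xs} same-length x∈xs px =
    proj₂ (∈-filter⁻ Q? {xs = xs} (subst (_ ∈_) (sym same-filter) (∈-filter⁺ P? x∈xs px)))
    where
    same-filter : filter Q? xs ≡ filter P? xs
    same-filter = Pointwise-≡⇒≡
      (toPointwise same-length
        (⊆-filter-Sublist Q? P? (λ { refl → Q⊆P }) (⊆-refl {x = xs})))

∈-allVertices : ∀ {r n} (u : Vertex r n) → u ∈ allVertices r n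
∈-allVertices (inj₁ o) = ∈-++⁺ˡ (∈-map⁺ inj₁ (∈-allFin o))
∈-allVertices {r} (inj₂ v) = ∈-++⁺ʳ (map inj₁ (allFin r)) (∈-map⁺ inj₂ (∈-allFin v))

from-injective : ∀ {n} (ν : Ordering n) {x y} → from ν x ≡ from ν y → x ≡ y
from-injective ν = Injection.injective (↔⇒↣ (↔-sym ν))

module _ {r n : ℕ} (G : Graph r n) where

  Before⇒< : ∀ (ν : Ordering n) j i → Before {r} ν j (inj₂ i) ≡ true → from ν i < j
  Before⇒< ν j i b = <ᵇ⇒< _ _ (Equivalence.from T-≡ b)

  <⇒Before : ∀ (ν : Ordering n) j i → from ν i < j → Before {r} ν j (inj₂ i) ≡ true
  <⇒Before ν j i i<j = Equivalence.to T-≡ (<⇒<ᵇ i<j)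

  adjacent-sym : ∀ {u w} → Adjacent G u w → Adjacent G w u
  adjacent-sym {u} {w} = trans (symmetric G w u)

  adjacent-irreflexive : ∀ {u} → ¬ Adjacent G u u
  adjacent-irreflexive {u} a = contradiction (trans (sym a) (irreflex G u)) λ ()

  isFather : Ordering n → Fin n → Vertex r n → Bool
  isFather ν x u = adj G (inj₂ x) u ∧ Before ν (from ν x) u

  isFather⇒FatherSet : ∀ {ν x u} → T (isFather ν x u) → FatherSet G ν x u
  isFather⇒FatherSet =
    Product.map (Equivalence.to T-≡) (Equivalence.to T-≡) ∘ Equivalence.to T-∧

  FatherSet⇒isFather : ∀ {ν x u} → FatherSet G ν x u → T (isFather ν x u)
  FatherSet⇒isFather =
    Equivalence.from T-∧ ∘ Product.map (Equivalence.from T-≡) (Equivalence.from T-≡)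

  fathers : Ordering n → Fin n → List (Vertex r n)
  fathers ν x = filter (T? ∘ isFather ν x) (allVertices r n)

  length-fathers : ∀ {ν} → ValidRearrangement G ν → ∀ x → length (fathers ν x) ≡ r
  length-fathers {ν} valid x =
    subst (λ z → length (filter (λ u → T? (adj G (inj₂ z) u ∧ Before ν (from ν x) u))
                                (allVertices r n)) ≡ r)
          (strictlyInverseˡ ν x) (proj₁ (valid (from ν x)))

  module _ {ν ν′ : Ordering n} where

    later-⊆⇒FatherSet-⊇ : ∀ x → (∀ {y} → from ν y > from ν x →
                                   FatherSet G ν y ⊆ FatherSet G ν′ y) →
                          FatherSet G ν′ x ⊆ FatherSet G ν x
    later-⊆⇒FatherSet-⊇ x later {inj₁ o} (adjacent , _) = adjacent , refl
    later-⊆⇒FatherSet-⊇ x later {inj₂ y} (adjacent , y-before′-x)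
      with <-cmp (from ν y) (from ν x)
    ... | tri< y<x _ _ = adjacent , <⇒Before ν _ y y<x
    ... | tri≈ _ y≡x _ = ⊥-elim (adjacent-irreflexive
            (subst (Adjacent G (inj₂ x) ∘ inj₂) (from-injective ν y≡x) adjacent))
    ... | tri> _ _ x<y = contradiction (Before⇒< ν′ _ y y-before′-x)
            (<-asym (Before⇒< ν′ _ x (proj₂ (later x<y
              (adjacent-sym adjacent , <⇒Before ν _ x x<y)))))

    module _ (valid : ValidRearrangement G ν) (valid′ : ValidRearrangement G ν′) where

      FatherSet-⊇⇒⊆ : ∀ x → FatherSet G ν′ x ⊆ FatherSet G ν x →
                      FatherSet G ν x ⊆ FatherSet G ν′ x
      FatherSet-⊇⇒⊆ x ⊇ {u} father = isFather⇒FatherSet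
        (filter-length-≡⇒⊇ (T? ∘ isFather ν x) (T? ∘ isFather ν′ x)
          (FatherSet⇒isFather ∘ ⊇ ∘ isFather⇒FatherSet)
          (trans (length-fathers valid′ x) (sym (length-fathers valid x)))
          (∈-allVertices u) (FatherSet⇒isFather father))

      FatherSet-⊆ : ∀ x → FatherSet G ν x ⊆ FatherSet G ν′ x
      FatherSet-⊆ = All.wfRec (wellFounded (from ν) >-wellFounded) 0ℓ
        (λ x → FatherSet G ν x ⊆ FatherSet G ν′ x)
        (λ x later → FatherSet-⊇⇒⊆ x (later-⊆⇒FatherSet-⊇ x later))

proposition3p3 : (r n : ℕ) (T : Graph r n) → IsRootedRTree T →
    (ν ν′ : Ordering n) → ValidRearrangement T ν → ValidRearrangement T ν′ →
    (i : Fin n) (u : Vertex r n) →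
    (FatherSet T ν i u → FatherSet T ν′ i u) × (FatherSet T ν′ i u → FatherSet T ν i u)
proposition3p3 r n T _ ν ν′ valid valid′ i u =
  FatherSet-⊆ T valid valid′ i , FatherSet-⊆ T valid′ valid i
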